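{- Let $m$ be an odd positive integer, $q=2^m$, and $A\in\mathbb{F}_q^*$. Let $\mu_{q^2+q+1}=\{x\in\mathbb{F}_{q^3}: x^{q^2+q+1}=1\}$. Then the equation $X^{q+1}+(A+1)X^{q}+A=0$ has no solution in $\mu_{q^2+q+1}\setminus\{1\}$.
   Context: $\mathbb{F}_{q}$ denotes the finite field with $q$ elements and $\mathbb{F}_q^*$ its nonzero elements; $\mathbb{F}_q\subseteq\mathbb{F}_{q^3}$. -}

module Defs where

open import Level using (Level; _⊔_)
open import Data.Nat using (ℕ)
import Data.Nat as N
open import Data.Fin using (Fin)
open import Data.Product using (∃)
open import Relation.Nullary using (¬_)
open import Algebra.Bundles using (CommutativeRing; Semiring)
import Algebra.Definitions.RawSemiring as RS
open import Function.Bundles using (Bijection)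
import Relation.Binary.PropositionalEquality as ≡

record IsField {c ℓ : Level} (R : CommutativeRing c ℓ) : Set (c ⊔ ℓ) where
  open CommutativeRing R
  field
    0≉1     : ¬ (0# ≈ 1#)
    inverse : ∀ x → ¬ (x ≈ 0#) → ∃ λ y → (x * y) ≈ 1#

HasCard : {c ℓ : Level} → CommutativeRing c ℓ → ℕ → Set (c ⊔ ℓ)
HasCard R n = Bijection (CommutativeRing.setoid R) (≡.setoid (Fin n))

pow : {c ℓ : Level} (R : CommutativeRing c ℓ) → CommutativeRing.Carrier R → ℕ → CommutativeRing.Carrier R
pow R = RS._^_ (Semiring.rawSemiring (CommutativeRing.semiring R))

-- m is odd (hence positive).
OddNat : ℕ → Set
OddNat m = ∃ λ k → m ≡.≡ 1 N.+ 2 N.* k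

-- Negation is an involution of a field whose only fixed point is 0 as soon as 1 + 1 is invertible,
-- and an involution of a finite set with a single fixed point forces the set to have odd size; so
-- the field, having 2^(3m) elements, has characteristic 2.  Put Y = X^q, Z = Y^q (so XYZ = 1)
-- and u = X + A + 1.  The equation says Y u = A, its image under the Frobenius x ↦ x^q says
-- Z (Y + A + 1) = A, and multiplying the two gives A²X = u (Y + A + 1) = A + (A + 1) u, that is
-- (A² + A + 1)(X + 1) = 0.  As X ≠ 1, A is a root of A² + A + 1, hence A³ = 1; but q ≡ 2 (mod 3)
-- for odd m, so A = A^q = A², and then A² + A + 1 = 1.
module Submission where

open import Defs
open import Level using (Level)
open import Data.Nat using (ℕ)
import Data.Nat as N
open import Relation.Nullary using (¬_; yes; no; contradiction)
open import Algebra.Bundles using (CommutativeRing; CommutativeSemiring; Semiring)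
open import Algebra.Definitions using (Congruent₁; Involutive; SelfInverse)
open import Data.Fin.Base using (Fin; zero; suc; punchIn; punchOut)
open import Data.Fin.Properties
  using (_≟_; punchIn-injective; punchInᵢ≢i; punchIn-punchOut; suc-injective)
open import Data.List.Base using ([]; _∷_)
open import Data.Nat.Base using (zero; suc; parity)
open import Data.Nat.Properties using (^-*-assoc)
open import Data.Nat.Tactic.RingSolver using () renaming (solve to solve-ℕ)
open import Data.Parity.Base using (0ℙ; 1ℙ; _⁻¹)
import Data.Parity.Base as ℙ
open import Data.Parity.Properties using (suc-homo-⁻¹; ⁻¹-selfInverse; *-homo-*)
open import Data.Product using (∃; _,_)
open import Data.Sum.Base using (_⊎_; inj₁; inj₂)
open import Function.Base using (_∘_)
open import Function.Bundles using (Bijection; Inverse)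
open import Function.Properties.Bijection using (Bijection⇒Inverse)
open import Relation.Binary.Bundles using (Setoid)
import Relation.Binary.PropositionalEquality as ≡
open ≡ using (_≡_; _≢_)
import Relation.Binary.Reasoning.Setoid as SetoidReasoning

4^k≡3t+1 : ∀ k → ∃ λ t → 4 N.^ k ≡ 3 N.* t N.+ 1
4^k≡3t+1 zero    = 0 , ≡.refl
4^k≡3t+1 (suc k) with 4^k≡3t+1 k
... | t , 4^k≡3t+1 = 4 N.* t N.+ 1 , (begin
  4 N.* 4 N.^ k               ≡⟨ ≡.cong (4 N.*_) 4^k≡3t+1 ⟩
  4 N.* (3 N.* t N.+ 1)       ≡⟨ solve-ℕ (t ∷ []) ⟩
  3 N.* (4 N.* t N.+ 1) N.+ 1 ∎)
  where open ≡.≡-Reasoning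

odd⇒2^m≡3t+2 : ∀ {m} → OddNat m → ∃ λ t → 2 N.^ m ≡ 3 N.* t N.+ 2
odd⇒2^m≡3t+2 (k , ≡.refl) with 4^k≡3t+1 k
... | t , 4^k≡3t+1 = 2 N.* t , (begin
  2 N.* 2 N.^ (2 N.* k)   ≡⟨ ≡.cong (2 N.*_) (^-*-assoc 2 2 k) ⟨
  2 N.* 4 N.^ k           ≡⟨ ≡.cong (2 N.*_) 4^k≡3t+1 ⟩
  2 N.* (3 N.* t N.+ 1)   ≡⟨ solve-ℕ (t ∷ []) ⟩
  3 N.* (2 N.* t) N.+ 2   ∎)
  where open ≡.≡-Reasoning

parity-[2^[1+k]]^[1+j] : ∀ k j → parity ((2 N.^ suc k) N.^ suc j) ≡ 0ℙ
parity-[2^[1+k]]^[1+j] k j =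
  ≡.trans (*-homo-* (2 N.^ suc k) _)
          (≡.cong (ℙ._* parity ((2 N.^ suc k) N.^ j)) (*-homo-* 2 (2 N.^ k)))

parity-suc : ∀ n {p} → parity n ≡ p → parity (suc n) ≡ p ⁻¹
parity-suc n e = ≡.sym (⁻¹-selfInverse (≡.trans (suc-homo-⁻¹ n) e))

involutive⇒selfInverse : ∀ {A : Set} (f : A → A) → Involutive _≡_ f → SelfInverse _≡_ f
involutive⇒selfInverse f f-inv {x} fx≡y = ≡.trans (≡.cong f (≡.sym fx≡y)) (f-inv x)

-- σ with the point a deleted, Fin n being identified with Fin (suc n) minus a through punchIn a;
-- the partner of a becomes a fixed point.
module Removal {n} (σ : Fin (suc n) → Fin (suc n)) (a : Fin (suc n)) where

  removed : Fin n → Fin n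
  removed x with a ≟ σ (punchIn a x)
  ... | yes _   = x
  ... | no a≢σx = punchOut a≢σx

  partner⇒removed-fixed : ∀ {x} → a ≡ σ (punchIn a x) → removed x ≡ x
  partner⇒removed-fixed {x} a≡σx with a ≟ σ (punchIn a x)
  ... | yes _   = ≡.refl
  ... | no a≢σx = contradiction a≡σx a≢σx

  punchIn-removed : ∀ {x} → a ≢ σ (punchIn a x) → punchIn a (removed x) ≡ σ (punchIn a x)
  punchIn-removed {x} a≢σx with a ≟ σ (punchIn a x)
  ... | yes a≡σx = contradiction a≡σx a≢σx
  ... | no _     = punchIn-punchOut a≢σx

  removed-fixed⇒partner⊎fixed : ∀ {x} → removed x ≡ x →
                                a ≡ σ (punchIn a x) ⊎ σ (punchIn a x) ≡ punchIn a x
  removed-fixed⇒partner⊎fixed {x} fx with a ≟ σ (punchIn a x)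
  ... | yes a≡σx = inj₁ a≡σx
  ... | no a≢σx  = inj₂ (≡.trans (≡.sym (punchIn-punchOut a≢σx)) (≡.cong (punchIn a) fx))

  removed-involutive : Involutive _≡_ σ → Involutive _≡_ removed
  removed-involutive σ-inv x with a ≟ σ (punchIn a x)
  ... | yes a≡σx = partner⇒removed-fixed a≡σx
  ... | no a≢σx  = punchIn-injective a _ x (≡.trans (punchIn-removed a≢σy) σy≡x)
    where
    σy≡x : σ (punchIn a (punchOut a≢σx)) ≡ punchIn a x
    σy≡x = involutive⇒selfInverse σ σ-inv (≡.sym (punchIn-punchOut a≢σx))
    a≢σy : a ≢ σ (punchIn a (punchOut a≢σx))
    a≢σy a≡σy = punchInᵢ≢i a x (≡.sym (≡.trans a≡σy σy≡x))

open Removal using (removed; partner⇒removed-fixed; removed-fixed⇒partner⊎fixed; removed-involutive)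

fixedPointFree⇒parity≡0ℙ : ∀ {n} (σ : Fin n → Fin n) → Involutive _≡_ σ →
  (∀ i → σ i ≢ i) → parity n ≡ 0ℙ
uniqueFixedPoint⇒parity≡1ℙ : ∀ {n} (σ : Fin n → Fin n) → Involutive _≡_ σ →
  ∀ {a} → σ a ≡ a → (∀ {i} → σ i ≡ i → i ≡ a) → parity n ≡ 1ℙ

fixedPointFree⇒parity≡0ℙ {zero}  σ σ-inv σi≢i = ≡.refl
fixedPointFree⇒parity≡0ℙ {suc n} σ σ-inv σi≢i with σ zero in σ0≡
... | zero  = contradiction σ0≡ (σi≢i zero)
... | suc j = parity-suc n (uniqueFixedPoint⇒parity≡1ℙ τ (removed-involutive σ zero σ-inv)
                            (partner⇒removed-fixed σ zero (≡.sym σ[1+j]≡0)) τx≡x⇒x≡j)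
  where
  τ : Fin n → Fin n
  τ = removed σ zero
  σ[1+j]≡0 : σ (suc j) ≡ zero
  σ[1+j]≡0 = involutive⇒selfInverse σ σ-inv σ0≡
  τx≡x⇒x≡j : ∀ {x} → τ x ≡ x → x ≡ j
  τx≡x⇒x≡j fx with removed-fixed⇒partner⊎fixed σ zero fx
  ... | inj₁ 0≡σ[1+x]   =
    suc-injective (≡.trans (≡.sym (involutive⇒selfInverse σ σ-inv (≡.sym 0≡σ[1+x]))) σ0≡)
  ... | inj₂ σ[1+x]≡1+x = contradiction σ[1+x]≡1+x (σi≢i _)

uniqueFixedPoint⇒parity≡1ℙ {suc n} σ σ-inv {a} σa≡a unique =
  parity-suc n (fixedPointFree⇒parity≡0ℙ τ (removed-involutive σ a σ-inv) τx≢x)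
  where
  τ : Fin n → Fin n
  τ = removed σ a
  τx≢x : ∀ x → τ x ≢ x
  τx≢x x fx with removed-fixed⇒partner⊎fixed σ a fx
  ... | inj₁ a≡σx =
    punchInᵢ≢i a x (≡.sym (≡.trans (≡.sym σa≡a) (involutive⇒selfInverse σ σ-inv (≡.sym a≡σx))))
  ... | inj₂ σx≡x = punchInᵢ≢i a x (unique σx≡x)

module _ {c ℓ} {S : Setoid c ℓ} {n} (card : Bijection S (≡.setoid (Fin n))) where
  open Setoid S
  open Inverse (Bijection⇒Inverse card)

  involution-uniqueFixedPoint⇒parity≡1ℙ :
    (f : Carrier → Carrier) → Congruent₁ _≈_ f → Involutive _≈_ f →
    ∀ {z} → f z ≈ z → (∀ {x} → f x ≈ x → x ≈ z) → parity n ≡ 1ℙ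
  involution-uniqueFixedPoint⇒parity≡1ℙ f f-cong f-inv {z} fz≈z unique =
    uniqueFixedPoint⇒parity≡1ℙ σ σ-inv σa≡a σi≡i⇒i≡a
    where
    σ : Fin n → Fin n
    σ i = to (f (from i))
    σ-inv : Involutive _≡_ σ
    σ-inv i = ≡.trans (to-cong (trans (f-cong (strictlyInverseʳ (f (from i)))) (f-inv (from i))))
                       (strictlyInverseˡ i)
    σa≡a : σ (to z) ≡ to z
    σa≡a = to-cong (trans (f-cong (strictlyInverseʳ z)) fz≈z)
    σi≡i⇒i≡a : ∀ {i} → σ i ≡ i → i ≡ to z
    σi≡i⇒i≡a {i} σi≡i = ≡.trans (≡.sym (strictlyInverseˡ i)) (to-cong (unique fx≈x))
      where
      fx≈x : f (from i) ≈ from i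
      fx≈x = trans (sym (strictlyInverseʳ (f (from i)))) (from-cong σi≡i)

module _ {c ℓ} (S : Semiring c ℓ) where
  open Semiring S
  open import Algebra.Properties.Semiring.Exp S
  open SetoidReasoning setoid

  1#^n≈1# : ∀ n → 1# ^ n ≈ 1#
  1#^n≈1# zero    = refl
  1#^n≈1# (suc n) = trans (*-identityˡ (1# ^ n)) (1#^n≈1# n)

  x^n≈1⇒x^[n*t+r]≈x^r : ∀ x n → x ^ n ≈ 1# → ∀ t r → x ^ (n N.* t N.+ r) ≈ x ^ r
  x^n≈1⇒x^[n*t+r]≈x^r x n x^n≈1 t r = begin
    x ^ (n N.* t N.+ r)   ≈⟨ ^-homo-* x (n N.* t) r ⟩
    x ^ (n N.* t) * x ^ r ≈⟨ *-congʳ (^-assocʳ x n t) ⟨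
    (x ^ n) ^ t * x ^ r   ≈⟨ *-congʳ (trans (^-congˡ t x^n≈1) (1#^n≈1# t)) ⟩
    1# * x ^ r            ≈⟨ *-identityˡ (x ^ r) ⟩
    x ^ r                 ∎

  x^[q*q+q+1]≈[x^q]^q*x^q*x : ∀ x q → x ^ (q N.* q N.+ q N.+ 1) ≈ (x ^ q) ^ q * x ^ q * x
  x^[q*q+q+1]≈[x^q]^q*x^q*x x q = begin
    x ^ (q N.* q N.+ q N.+ 1)       ≈⟨ ^-homo-* x (q N.* q N.+ q) 1 ⟩
    x ^ (q N.* q N.+ q) * x ^ 1     ≈⟨ *-cong (^-homo-* x (q N.* q) q) (*-identityʳ x) ⟩
    x ^ (q N.* q) * x ^ q * x       ≈⟨ *-congʳ (*-congʳ (^-assocʳ x q q)) ⟨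
    (x ^ q) ^ q * x ^ q * x         ∎

module _ {c ℓ} (S : CommutativeSemiring c ℓ) where
  open CommutativeSemiring S
  open import Algebra.Properties.Semiring.Exp semiring
  open import Algebra.Properties.CommutativeSemiring.Exp S using (^-distrib-*)
  open import Algebra.Solver.Ring.NaturalCoefficients.Default S
  open SetoidReasoning setoid

  x*x+x+1≈0⇒x^3≈1 : ∀ {x} → x * x + x + 1# ≈ 0# → x ^ 3 ≈ 1#
  x*x+x+1≈0⇒x^3≈1 {x} x*x+x+1≈0 = begin
    x ^ 3                           ≈⟨ +-identityʳ (x ^ 3) ⟨
    x ^ 3 + 0#                      ≈⟨ +-congˡ x*x+x+1≈0 ⟨
    x ^ 3 + (x * x + x + 1#)        ≈⟨ solve 1 (λ x → x :^ 3 :+ (x :* x :+ x :+ con 1)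
                                                   := x :* (x :* x :+ x :+ con 1) :+ con 1) refl x ⟩
    x * (x * x + x + 1#) + 1#       ≈⟨ +-congʳ (*-congˡ x*x+x+1≈0) ⟩
    x * 0# + 1#                     ≈⟨ +-congʳ (zeroʳ x) ⟩
    0# + 1#                         ≈⟨ +-identityˡ 1# ⟩
    1#                              ∎

  x*x+x+1≈0⇒x^[2^m]≈x*x : ∀ {m} → OddNat m → ∀ {x} → x * x + x + 1# ≈ 0# →
                          x ^ (2 N.^ m) ≈ x * x
  x*x+x+1≈0⇒x^[2^m]≈x*x {m} m-odd {x} x*x+x+1≈0 with odd⇒2^m≡3t+2 m-odd
  ... | t , 2^m≡3t+2 = begin
    x ^ (2 N.^ m)         ≈⟨ ^-congʳ x 2^m≡3t+2 ⟩
    x ^ (3 N.* t N.+ 2)   ≈⟨ x^n≈1⇒x^[n*t+r]≈x^r semiring x 3 (x*x+x+1≈0⇒x^3≈1 x*x+x+1≈0) t 2 ⟩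
    x * (x * 1#)          ≈⟨ *-congˡ (*-identityʳ x) ⟩
    x * x                 ∎

  module Characteristic2 (1+1≈0 : 1# + 1# ≈ 0#) where

    x+x≈0 : ∀ x → x + x ≈ 0#
    x+x≈0 x = begin
      x + x             ≈⟨ +-cong (*-identityˡ x) (*-identityˡ x) ⟨
      1# * x + 1# * x   ≈⟨ distribʳ x 1# 1# ⟨
      (1# + 1#) * x     ≈⟨ *-congʳ 1+1≈0 ⟩
      0# * x            ≈⟨ zeroˡ x ⟩
      0#                ∎

    x+y≈0⇒x≈y : ∀ {x y} → x + y ≈ 0# → x ≈ y
    x+y≈0⇒x≈y {x} {y} x+y≈0 = begin
      x             ≈⟨ +-identityʳ x ⟨
      x + 0#        ≈⟨ +-congˡ (x+x≈0 y) ⟨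
      x + (y + y)   ≈⟨ +-assoc x y y ⟨
      x + y + y     ≈⟨ +-congʳ x+y≈0 ⟩
      0# + y        ≈⟨ +-identityˡ y ⟩
      y             ∎

    x*x≈x⇒x*x+x+1≈1 : ∀ {x} → x * x ≈ x → x * x + x + 1# ≈ 1#
    x*x≈x⇒x*x+x+1≈1 {x} x*x≈x = begin
      x * x + x + 1#   ≈⟨ +-congʳ (+-congʳ x*x≈x) ⟩
      x + x + 1#       ≈⟨ +-congʳ (x+x≈0 x) ⟩
      0# + 1#          ≈⟨ +-identityˡ 1# ⟩
      1#               ∎

    frobenius : ∀ k x y → (x + y) ^ (2 N.^ k) ≈ x ^ (2 N.^ k) + y ^ (2 N.^ k)
    frobenius zero    x y = distribʳ 1# x y
    frobenius (suc k) x y = begin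
      (x + y) ^ (2 N.* 2 N.^ k)                   ≈⟨ ^-assocʳ (x + y) 2 (2 N.^ k) ⟨
      ((x + y) ^ 2) ^ (2 N.^ k)                   ≈⟨ ^-congˡ (2 N.^ k) (square x y) ⟩
      (x ^ 2 + y ^ 2) ^ (2 N.^ k)                 ≈⟨ frobenius k (x ^ 2) (y ^ 2) ⟩
      (x ^ 2) ^ (2 N.^ k) + (y ^ 2) ^ (2 N.^ k)   ≈⟨ +-cong (^-assocʳ x 2 (2 N.^ k))
                                                            (^-assocʳ y 2 (2 N.^ k)) ⟩
      x ^ (2 N.* 2 N.^ k) + y ^ (2 N.* 2 N.^ k)   ∎
      where
      square : ∀ x y → (x + y) ^ 2 ≈ x ^ 2 + y ^ 2
      square x y = begin
        (x + y) ^ 2                       ≈⟨ solve 2 (λ x y → (x :+ y) :^ 2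
                                                := x :^ 2 :+ y :^ 2 :+ (x :* y :+ x :* y)) refl x y ⟩
        x ^ 2 + y ^ 2 + (x * y + x * y)   ≈⟨ +-congˡ (x+x≈0 (x * y)) ⟩
        x ^ 2 + y ^ 2 + 0#                ≈⟨ +-identityʳ _ ⟩
        x ^ 2 + y ^ 2                     ∎

    root⇒[A*A+A+1]*[X+1]≈0 : ∀ k {A X} → let q = 2 N.^ k in
      A ^ q ≈ A → X ^ (q N.* q N.+ q N.+ 1) ≈ 1# → X ^ (q N.+ 1) + (A + 1#) * X ^ q + A ≈ 0# →
      (A * A + A + 1#) * (X + 1#) ≈ 0#
    root⇒[A*A+A+1]*[X+1]≈0 k {A} {X} A^q≈A X^[q*q+q+1]≈1 root = begin
      (A * A + A + 1#) * (X + 1#)                 ≈⟨ +-identityʳ _ ⟨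
      (A * A + A + 1#) * (X + 1#) + 0#            ≈⟨ +-congˡ (x+x≈0 A) ⟨
      (A * A + A + 1#) * (X + 1#) + (A + A)       ≈⟨ solve 2 (λ A X →
                                                       (A :* A :+ A :+ con 1) :* (X :+ con 1) :+ (A :+ A)
                                                    := A :* A :* X :+ (A :+ (A :+ con 1) :* (X :+ A :+ con 1)))
                                                    refl A X ⟩
      A * A * X + (A + (A + 1#) * u)              ≈⟨ +-congʳ A*A*X≈A+[A+1]*u ⟩
      (A + (A + 1#) * u) + (A + (A + 1#) * u)     ≈⟨ x+x≈0 _ ⟩
      0#                                          ∎
      where
      q : ℕ
      q = 2 N.^ k
      Y Z u : Carrier
      Y = X ^ q
      Z = Y ^ q
      u = X + A + 1#
      Y*u≈A : Y * u ≈ A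
      Y*u≈A = x+y≈0⇒x≈y (begin
        Y * u + A                         ≈⟨ +-congʳ (solve 3 (λ X Y A → Y :* (X :+ A :+ con 1)
                                               := Y :* X :+ (A :+ con 1) :* Y) refl X Y A) ⟩
        Y * X + (A + 1#) * Y + A          ≈⟨ +-congʳ (+-congʳ X^[q+1]≈Y*X) ⟨
        X ^ (q N.+ 1) + (A + 1#) * Y + A  ≈⟨ root ⟩
        0#                                ∎)
        where
        X^[q+1]≈Y*X : X ^ (q N.+ 1) ≈ Y * X
        X^[q+1]≈Y*X = trans (^-homo-* X q 1) (*-congˡ (*-identityʳ X))
      Z*[Y+A+1]≈A : Z * (Y + A + 1#) ≈ A
      Z*[Y+A+1]≈A = begin
        Z * (Y + A + 1#)            ≈⟨ *-congˡ (+-cong (+-congˡ A^q≈A) (1#^n≈1# semiring q)) ⟨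
        Z * (Y + A ^ q + 1# ^ q)    ≈⟨ *-congˡ (trans (frobenius k (X + A) 1#)
                                                      (+-congʳ (frobenius k X A))) ⟨
        Z * u ^ q                   ≈⟨ ^-distrib-* Y u q ⟨
        (Y * u) ^ q                 ≈⟨ ^-congˡ q Y*u≈A ⟩
        A ^ q                       ≈⟨ A^q≈A ⟩
        A                           ∎
      A*A*X≈A+[A+1]*u : A * A * X ≈ A + (A + 1#) * u
      A*A*X≈A+[A+1]*u = begin
        A * A * X                           ≈⟨ *-congʳ (*-cong Y*u≈A Z*[Y+A+1]≈A) ⟨
        Y * u * (Z * (Y + A + 1#)) * X      ≈⟨ solve 4 (λ X Y Z A →
                                                   Y :* (X :+ A :+ con 1) :* (Z :* (Y :+ A :+ con 1)) :* X
                                                := Z :* Y :* X :* ((X :+ A :+ con 1) :* (Y :+ A :+ con 1)))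
                                                refl X Y Z A ⟩
        Z * Y * X * (u * (Y + A + 1#))      ≈⟨ *-congʳ Z*Y*X≈1 ⟩
        1# * (u * (Y + A + 1#))             ≈⟨ *-identityˡ _ ⟩
        u * (Y + A + 1#)                    ≈⟨ solve 3 (λ X Y A → (X :+ A :+ con 1) :* (Y :+ A :+ con 1)
                                                := Y :* (X :+ A :+ con 1) :+ (A :+ con 1) :* (X :+ A :+ con 1)) refl X Y A ⟩
        Y * u + (A + 1#) * u                ≈⟨ +-congʳ Y*u≈A ⟩
        A + (A + 1#) * u                    ∎
        where
        Z*Y*X≈1 : Z * Y * X ≈ 1#
        Z*Y*X≈1 = trans (sym (x^[q*q+q+1]≈[x^q]^q*x^q*x semiring X q)) X^[q*q+q+1]≈1

module _ {c ℓ} (R : CommutativeRing c ℓ) where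
  open CommutativeRing R
  open import Algebra.Properties.Ring ring using (-0#≈0#; -‿involutive)
  open import Algebra.Solver.Ring.NaturalCoefficients.Default commutativeSemiring
  open SetoidReasoning setoid

  -x≈x⇒x≈0 : ∀ {t} → (1# + 1#) * t ≈ 1# → ∀ {x} → - x ≈ x → x ≈ 0#
  -x≈x⇒x≈0 {t} 2t≈1 {x} -x≈x = begin
    x                   ≈⟨ *-identityˡ x ⟨
    1# * x              ≈⟨ *-congʳ 2t≈1 ⟨
    (1# + 1#) * t * x   ≈⟨ solve 2 (λ t x → (con 1 :+ con 1) :* t :* x := t :* (x :+ x)) refl t x ⟩
    t * (x + x)         ≈⟨ *-congˡ (+-congˡ -x≈x) ⟨
    t * (x + - x)       ≈⟨ *-congˡ (-‿inverseʳ x) ⟩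
    t * 0#              ≈⟨ zeroʳ t ⟩
    0#                  ∎

  1+1-invertible⇒parity≡1ℙ : ∀ {n} → HasCard R n → ∀ {t} → (1# + 1#) * t ≈ 1# → parity n ≡ 1ℙ
  1+1-invertible⇒parity≡1ℙ card 2t≈1 =
    involution-uniqueFixedPoint⇒parity≡1ℙ card -_ -‿cong -‿involutive -0#≈0# (-x≈x⇒x≈0 2t≈1)

  module _ (R-field : IsField R) where
    open IsField R-field

    parity≡0ℙ⇒¬¬1+1≈0 : ∀ {n} → HasCard R n → parity n ≡ 0ℙ → ¬ ¬ (1# + 1# ≈ 0#)
    parity≡0ℙ⇒¬¬1+1≈0 card even 1+1≉0 with inverse (1# + 1#) 1+1≉0
    ... | t , 2t≈1 with ≡.trans (≡.sym even) (1+1-invertible⇒parity≡1ℙ card 2t≈1)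
    ... | ()

    x*y≈0⇒y≉0⇒x≈0 : ∀ {x y} → x * y ≈ 0# → ¬ (y ≈ 0#) → x ≈ 0#
    x*y≈0⇒y≉0⇒x≈0 {x} {y} xy≈0 y≉0 with inverse y y≉0
    ... | t , yt≈1 = begin
      x             ≈⟨ *-identityʳ x ⟨
      x * 1#        ≈⟨ *-congˡ yt≈1 ⟨
      x * (y * t)   ≈⟨ *-assoc x y t ⟨
      x * y * t     ≈⟨ *-congʳ xy≈0 ⟩
      0# * t        ≈⟨ zeroˡ t ⟩
      0#            ∎

lemma3p2 : {c ℓ : Level} (m : ℕ) → OddNat m →
  (F : CommutativeRing c ℓ) → IsField F → HasCard F ((2 N.^ m) N.^ 3) →
  let open CommutativeRing F
      q = 2 N.^ m
  in (A : Carrier) → pow F A q ≈ A → ¬ (A ≈ 0#) →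
     (X : Carrier) → pow F X (q N.* q N.+ q N.+ 1) ≈ 1# → ¬ (X ≈ 1#) →
     ¬ ((pow F X (q N.+ 1) + (A + 1#) * pow F X q) + A ≈ 0#)
lemma3p2 .(1 N.+ 2 N.* k) m-odd@(k , ≡.refl) F F-field card A A^q≈A _ X X^[q*q+q+1]≈1 X≉1 root =
  parity≡0ℙ⇒¬¬1+1≈0 F F-field card (parity-[2^[1+k]]^[1+j] (2 N.* k) 2) λ 1+1≈0 →
    let open Characteristic2 commutativeSemiring 1+1≈0
        m : ℕ
        m = 1 N.+ 2 N.* k
        A*A+A+1≈0 : A * A + A + 1# ≈ 0#
        A*A+A+1≈0 = x*y≈0⇒y≉0⇒x≈0 F F-field (root⇒[A*A+A+1]*[X+1]≈0 m A^q≈A X^[q*q+q+1]≈1 root)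
                                            (X≉1 ∘ x+y≈0⇒x≈y)
        A*A≈A : A * A ≈ A
        A*A≈A = trans (sym (x*x+x+1≈0⇒x^[2^m]≈x*x commutativeSemiring m-odd A*A+A+1≈0)) A^q≈A
    in IsField.0≉1 F-field (trans (sym A*A+A+1≈0) (x*x≈x⇒x*x+x+1≈1 A*A≈A))
  where open CommutativeRing F
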